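{- Let $0 \leq k \leq n$ be integers. Then $F(n,k)=F(n,n-k)$ and $G(n,k)=G(n,n-k)$.
   Context: $Q_n$ is the $n$-dimensional Boolean hypercube with vertex set $\{ -1,1\}^n$, two vertices being adjacent iff they differ in exactly one coordinate; $\Gamma(x)$ denotes the neighbourhood of $x$. A Boolean function on $Q_n$ is a function $f:\{ -1,1\}^n\to\{ -1,1\}$. A $k$-function is a Boolean function $f$ on $Q_n$ such that for every vertex $v$, $|\{w\in\Gamma(v): f(v)\neq f(w)\}|=k$. Two real-valued functions $f,g$ on $Q_n$ are isomorphic if there is a graph automorphism $\phi$ of $Q_n$ and a sign $\epsilon\in\{ -1,1\}$ with $f=\epsilon\, g\circ\phi$. $F(n,k)$ denotes the number of $k$-functions on $Q_n$ and $G(n,k)$ the number of isomorphism classes of $k$-functions on $Q_n$. -}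

module Defs where

open import Data.Nat using (ℕ; zero; suc; _≡ᵇ_)
open import Data.Bool using (Bool; true; false; not; if_then_else_; _∧_)
open import Data.Bool.Properties using () renaming (_≟_ to _≟ᵇ_)
open import Data.Fin using (Fin)
open import Data.Vec using (Vec; []; _∷_; _[_]%=_; allFin; toList)
open import Data.List using (List; []; _∷_; length; filter; map; concatMap)
open import Data.Product using (Σ; _×_; _,_; ∃; ∃-syntax)
open import Relation.Binary.PropositionalEquality using (_≡_)
open import Relation.Nullary using (¬_; does)
open import Function.Bundles using (Inverse; _↔_)
open import Data.List.Membership.Propositional using (_∈_)
open import Data.List.Relation.Unary.All using (All)
open import Data.List.Relation.Unary.AllPairs using (AllPairs)
open import Data.List.Relation.Unary.Any using (Any)

count : ∀ {A : Set} → (A → Bool) → List A → ℕ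
count p [] = 0
count p (x ∷ xs) = if p x then suc (count p xs) else count p xs

allᵇ : ∀ {A : Set} → (A → Bool) → List A → Bool
allᵇ p [] = true
allᵇ p (x ∷ xs) = p x ∧ allᵇ p xs

-- Vertices of Q_n: {-1,1}^n, encoded as Bool-vectors (true ↔ 1, false ↔ -1).
Vertex : ℕ → Set
Vertex n = Vec Bool n

-- Boolean functions on Q_n (values {-1,1} encoded as Bool; negation = not).
BoolFun : ℕ → Set
BoolFun n = Vertex n → Bool

-- the neighbour of v obtained by flipping coordinate i;
-- Γ(v) = { flip i v | i : Fin n }, and i ↦ flip i v is injective
flip : ∀ {n} → Fin n → Vertex n → Vertex n
flip i v = v [ i ]%= not

disagree : ∀ {n} → BoolFun n → Vertex n → ℕ
disagree {n} f v =
  count (λ w → not (does (f v ≟ᵇ f w))) (map (λ i → flip i v) (toList (allFin n)))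

IsKFun : ∀ {n} → ℕ → BoolFun n → Set
IsKFun k f = ∀ v → disagree f v ≡ k

allVertices : (n : ℕ) → List (Vertex n)
allVertices zero = [] ∷ []
allVertices (suc n) = concatMap (λ v → (false ∷ v) ∷ (true ∷ v) ∷ []) (allVertices n)

-- explicit enumeration of all Boolean functions on Q_n (each exactly once)
allFuns : (n : ℕ) → List (BoolFun n)
allFuns zero = (λ _ → false) ∷ (λ _ → true) ∷ []
allFuns (suc n) =
  concatMap (λ f₀ → map (λ f₁ → λ { (false ∷ v) → f₀ v ; (true ∷ v) → f₁ v }) (allFuns n))
            (allFuns n)

isKFunᵇ : ∀ {n} → ℕ → BoolFun n → Bool
isKFunᵇ {n} k f = allᵇ (λ v → disagree f v ≡ᵇ k) (allVertices n)

F : ℕ → ℕ → ℕ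
F n k = count (isKFunᵇ k) (allFuns n)

dist : ∀ {n} → Vertex n → Vertex n → ℕ
dist [] [] = 0
dist (a ∷ v) (b ∷ w) = if does (a ≟ᵇ b) then dist v w else suc (dist v w)

Adj : ∀ {n} → Vertex n → Vertex n → Set
Adj v w = dist v w ≡ 1

record Automorphism (n : ℕ) : Set where
  field
    bij      : Vertex n ↔ Vertex n
    preserve : ∀ x y → (Adj x y → Adj (Inverse.to bij x) (Inverse.to bij y))
                     × (Adj (Inverse.to bij x) (Inverse.to bij y) → Adj x y)

-- sign ε ∈ {-1,1} acting on {-1,1}: true = +1 (identity), false = -1 (negation)
applySign : Bool → Bool → Bool
applySign true  b = b
applySign false b = not b

Isomorphic : ∀ {n} → BoolFun n → BoolFun n → Set
Isomorphic {n} f g =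
  ∃[ φ ] ∃[ ε ] (∀ x → f x ≡ applySign ε (g (Inverse.to (Automorphism.bij {n} φ) x)))

-- "G(n,k) = m": there are exactly m isomorphism classes of k-functions on Q_n,
-- witnessed by a list of m pairwise non-isomorphic k-functions such that
-- every k-function is isomorphic to one of them.
IsG : ℕ → ℕ → ℕ → Set
IsG n k m =
  ∃[ reps ] (length reps ≡ m
            × All (IsKFun k) reps
            × AllPairs (λ f g → ¬ Isomorphic f g) reps
            × (∀ (f : BoolFun n) → IsKFun k f → Any (Isomorphic f) reps))

-- Multiplying f by the parity character χ(v) = v₁⋯vₙ turns every edge on which f
-- disagrees into one on which it agrees and vice versa, since χ changes sign along
-- every edge of Q_n; so the involution f ↦ χf maps k-functions to (n−k)-functions.
-- It permutes the set of all Boolean functions, whence F(n,k) = F(n,n−k). As Q_n is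
-- connected and bipartite, every automorphism φ satisfies χ∘φ = ±χ, so f ↦ χf also
-- respects isomorphism and transports systems of representatives of the classes.
module Submission where

open import Defs
open import Data.Nat using (ℕ; zero; suc; _+_; _≤_; _∸_; _≡ᵇ_)
open import Data.Nat.ListAction using (sum)
open import Data.Nat.ListAction.Properties using (sum-++)
open import Data.Nat.Properties
  using (+-comm; +-identityʳ; +-suc; suc-injective; m+n∸n≡m; m+n∸m≡n; m∸[m∸n]≡n; m∸n≤m; _≟_)
open import Data.Bool using (Bool; true; false; not; _xor_; _∧_; if_then_else_)
open import Data.Bool.Properties
  using (not-involutive; not-distribˡ-xor; not-distribʳ-xor; xor-assoc; xor-same; xor-identityʳ; xor-annihilates-not)
  renaming (_≟_ to _≟ᵇ_)
open import Data.Fin using (Fin) renaming (zero to fzero; suc to fsuc)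
open import Data.Vec using ([]; _∷_; allFin; toList; replicate)
open import Data.Vec.Properties using (length-toList)
open import Data.List using ([]; _∷_; _++_; length; map; concatMap)
open import Data.List.Properties using (map-++; map-cong; map-∘; length-map)
open import Data.Product using (_×_; _,_; proj₁; proj₂; ∃-syntax)
open import Function using (_∘_)
open import Function.Bundles using (_⇔_; mk⇔; Inverse; module Equivalence)
open import Relation.Nullary using (does)
open import Relation.Nullary.Decidable using (does-⇔)
open import Relation.Binary.PropositionalEquality
  using (_≡_; _≗_; refl; sym; trans; cong; cong₂; subst; module ≡-Reasoning)
import Data.List.Relation.Unary.All as All
import Data.List.Relation.Unary.All.Properties as All
import Data.List.Relation.Unary.Any as Any
import Data.List.Relation.Unary.Any.Properties as Any
import Data.List.Relation.Unary.AllPairs as AllPairs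
import Data.List.Relation.Unary.AllPairs.Properties as AllPairs

private
  variable
    A B C : Set
    n : ℕ

count-cong : {p q : A → Bool} → p ≗ q → ∀ xs → count p xs ≡ count q xs
count-cong p≗q [] = refl
count-cong {p = p} {q} p≗q (x ∷ xs) with p x | q x | p≗q x
... | true  | .true  | refl = cong suc (count-cong p≗q xs)
... | false | .false | refl = count-cong p≗q xs

count-map : (p : B → Bool) (g : A → B) → ∀ xs → count p (map g xs) ≡ count (p ∘ g) xs
count-map p g [] = refl
count-map p g (x ∷ xs) with p (g x)
... | true  = cong suc (count-map p g xs)
... | false = count-map p g xs

count-not+count : (p : A → Bool) → ∀ xs → count (not ∘ p) xs + count p xs ≡ length xs
count-not+count p [] = refl
count-not+count p (x ∷ xs) with p x
... | true  = trans (+-suc _ _) (cong suc (count-not+count p xs))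
... | false = cong suc (count-not+count p xs)

indicator : Bool → ℕ
indicator b = if b then 1 else 0

count≡sum : (p : A → Bool) → ∀ xs → count p xs ≡ sum (map (indicator ∘ p) xs)
count≡sum p [] = refl
count≡sum p (x ∷ xs) with p x
... | true  = cong suc (count≡sum p xs)
... | false = count≡sum p xs

sum-map-concatMap-map : (w : C → ℕ) (h : A → B → C) → ∀ xs ys →
  sum (map w (concatMap (λ x → map (h x) ys) xs)) ≡ sum (map (λ x → sum (map (w ∘ h x) ys)) xs)
sum-map-concatMap-map w h [] ys = refl
sum-map-concatMap-map w h (x ∷ xs) ys = begin
  sum (map w (map (h x) ys ++ rest))                 ≡⟨ cong sum (map-++ w (map (h x) ys) rest) ⟩
  sum (map w (map (h x) ys) ++ map w rest)           ≡⟨ sum-++ (map w (map (h x) ys)) (map w rest) ⟩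
  sum (map w (map (h x) ys)) + sum (map w rest)      ≡⟨ cong₂ _+_ (cong sum (sym (map-∘ ys)))
                                                                  (sum-map-concatMap-map w h xs ys) ⟩
  sum (map (w ∘ h x) ys) + sum (map (λ x → sum (map (w ∘ h x) ys)) xs) ∎
  where
  open ≡-Reasoning
  rest = concatMap (λ x → map (h x) ys) xs

allᵇ-cong : {p q : A → Bool} → p ≗ q → ∀ xs → allᵇ p xs ≡ allᵇ q xs
allᵇ-cong p≗q [] = refl
allᵇ-cong p≗q (x ∷ xs) = cong₂ _∧_ (p≗q x) (allᵇ-cong p≗q xs)

Extensional : (BoolFun n → ℕ) → Set
Extensional w = ∀ {f g} → f ≗ g → w f ≡ w g

twist : (Vertex n → Bool) → BoolFun n → BoolFun n
twist c f v = f v xor c v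

-- Without function extensionality, f ↦ twist c f permutes allFuns n only up to ≗,
-- so invariance is stated for weights that respect ≗.
TwistInvariant : ℕ → Set
TwistInvariant n = ∀ (c : Vertex n → Bool) (w : BoolFun n → ℕ) → Extensional w →
  sum (map (w ∘ twist c) (allFuns n)) ≡ sum (map w (allFuns n))

-- allFuns (suc n) glues two functions on Q_n by an anonymous pattern lambda, which
-- can only be referred to through these equations.
IsGluing : (BoolFun n → BoolFun n → BoolFun (suc n)) → Set
IsGluing glue = ∀ f₀ f₁ v → glue f₀ f₁ (false ∷ v) ≡ f₀ v × glue f₀ f₁ (true ∷ v) ≡ f₁ v

module _ {glue : BoolFun n → BoolFun n → BoolFun (suc n)} (gluing : IsGluing glue) where

  glue-cong : ∀ {f₀ g₀ f₁ g₁} → f₀ ≗ g₀ → f₁ ≗ g₁ → glue f₀ f₁ ≗ glue g₀ g₁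
  glue-cong {f₀} {g₀} {f₁} {g₁} e₀ e₁ (false ∷ v) =
    trans (proj₁ (gluing f₀ f₁ v)) (trans (e₀ v) (sym (proj₁ (gluing g₀ g₁ v))))
  glue-cong {f₀} {g₀} {f₁} {g₁} e₀ e₁ (true ∷ v) =
    trans (proj₂ (gluing f₀ f₁ v)) (trans (e₁ v) (sym (proj₂ (gluing g₀ g₁ v))))

  twist-glue : ∀ c f₀ f₁ →
    twist c (glue f₀ f₁) ≗ glue (twist (c ∘ (false ∷_)) f₀) (twist (c ∘ (true ∷_)) f₁)
  twist-glue c f₀ f₁ (false ∷ v) =
    trans (cong (_xor c (false ∷ v)) (proj₁ (gluing f₀ f₁ v))) (sym (proj₁ (gluing _ _ v)))
  twist-glue c f₀ f₁ (true ∷ v) =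
    trans (cong (_xor c (true ∷ v)) (proj₂ (gluing f₀ f₁ v))) (sym (proj₂ (gluing _ _ v)))

  twistInvariant-glue : TwistInvariant n → ∀ c (w : BoolFun (suc n) → ℕ) → Extensional w →
    let Fs = concatMap (λ f₀ → map (glue f₀) (allFuns n)) (allFuns n)
    in sum (map (w ∘ twist c) Fs) ≡ sum (map w Fs)
  twistInvariant-glue invariant c w w-ext = begin
    sum (map (w ∘ twist c) (concatMap (λ f₀ → map (glue f₀) L) L))
      ≡⟨ sum-map-concatMap-map (w ∘ twist c) glue L L ⟩
    sum (map (λ f₀ → sum (map (λ f₁ → w (twist c (glue f₀ f₁))) L)) L)
      ≡⟨ cong sum (map-cong (λ f₀ → cong sum (map-cong (λ f₁ → w-ext (twist-glue c f₀ f₁)) L)) L) ⟩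
    sum (map (λ f₀ → sum (map (λ f₁ → w (glue (twist c₀ f₀) (twist c₁ f₁))) L)) L)
      ≡⟨ cong sum (map-cong (λ f₀ → invariant c₁ (w ∘ glue (twist c₀ f₀))
                                      (λ e → w-ext (glue-cong (λ _ → refl) e))) L) ⟩
    sum (map (λ f₀ → sum (map (λ f₁ → w (glue (twist c₀ f₀) f₁)) L)) L)
      ≡⟨ invariant c₀ (λ f₀ → sum (map (w ∘ glue f₀) L))
                      (λ e → cong sum (map-cong (λ _ → w-ext (glue-cong e (λ _ → refl))) L)) ⟩
    sum (map (λ f₀ → sum (map (w ∘ glue f₀) L)) L)
      ≡⟨ sum-map-concatMap-map w glue L L ⟨
    sum (map w (concatMap (λ f₀ → map (glue f₀) L) L)) ∎
    where
    open ≡-Reasoning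
    L = allFuns n
    c₀ = c ∘ (false ∷_)
    c₁ = c ∘ (true ∷_)

twistInvariant : ∀ n → TwistInvariant n
twistInvariant zero c w w-ext = begin
  w (twist c (λ _ → false)) + (w (twist c (λ _ → true)) + 0)
    ≡⟨ cong₂ (λ a b → a + (b + 0)) (w-ext λ { [] → refl }) (w-ext λ { [] → refl }) ⟩
  W (c []) + (W (not (c [])) + 0)
    ≡⟨ swap (c []) ⟩
  W false + (W true + 0) ∎
  where
  open ≡-Reasoning
  W : Bool → ℕ
  W b = w (λ _ → b)
  swap : ∀ b → W b + (W (not b) + 0) ≡ W false + (W true + 0)
  swap false = refl
  swap true  = begin
    W true + (W false + 0)  ≡⟨ cong (W true +_) (+-identityʳ (W false)) ⟩
    W true + W false        ≡⟨ +-comm (W true) (W false) ⟩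
    W false + W true        ≡⟨ cong (W false +_) (+-identityʳ (W true)) ⟨
    W false + (W true + 0)  ∎
twistInvariant (suc n) = twistInvariant-glue (λ _ _ _ → refl , refl) (twistInvariant n)

parity : Vertex n → Bool
parity [] = false
parity (b ∷ v) = b xor parity v

-- With true ↔ 1, xor is multiplication up to sign, so dual f is ±χf; the sign is global.
dual : BoolFun n → BoolFun n
dual = twist parity

xor-cancelʳ : ∀ a b → (a xor b) xor b ≡ a
xor-cancelʳ a b = trans (xor-assoc a b b) (trans (cong (a xor_) (xor-same b)) (xor-identityʳ a))

dual-involutive : (f : BoolFun n) → dual (dual f) ≗ f
dual-involutive f v = xor-cancelʳ (f v) (parity v)

parity-flip : ∀ (i : Fin n) v → parity (flip i v) ≡ not (parity v)
parity-flip fzero    (b ∷ v) = sym (not-distribˡ-xor b (parity v))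
parity-flip (fsuc i) (b ∷ v) = trans (cong (b xor_) (parity-flip i v)) (sym (not-distribʳ-xor b (parity v)))

disagreesᵇ-xor-not : ∀ a b p → not (does (a xor p ≟ᵇ b xor not p)) ≡ does (a ≟ᵇ b)
disagreesᵇ-xor-not false false false = refl
disagreesᵇ-xor-not false false true  = refl
disagreesᵇ-xor-not false true  false = refl
disagreesᵇ-xor-not false true  true  = refl
disagreesᵇ-xor-not true  false false = refl
disagreesᵇ-xor-not true  false true  = refl
disagreesᵇ-xor-not true  true  false = refl
disagreesᵇ-xor-not true  true  true  = refl

disagree-dual+disagree : (f : BoolFun n) → ∀ v → disagree (dual f) v + disagree f v ≡ n
disagree-dual+disagree {n} f v = begin
  disagree (dual f) v + disagree f v
    ≡⟨ cong₂ _+_ (count-map _ (λ i → flip i v) is) (count-map _ (λ i → flip i v) is) ⟩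
  count (λ i → not (does (dual f v ≟ᵇ dual f (flip i v)))) is + count (not ∘ agrees) is
    ≡⟨ cong (_+ count (not ∘ agrees) is) (count-cong dual-disagrees≗agrees is) ⟩
  count agrees is + count (not ∘ agrees) is
    ≡⟨ +-comm (count agrees is) _ ⟩
  count (not ∘ agrees) is + count agrees is
    ≡⟨ count-not+count agrees is ⟩
  length is
    ≡⟨ length-toList (allFin n) ⟩
  n ∎
  where
  open ≡-Reasoning
  is = toList (allFin n)
  agrees : Fin n → Bool
  agrees i = does (f v ≟ᵇ f (flip i v))
  dual-disagrees≗agrees : (λ i → not (does (dual f v ≟ᵇ dual f (flip i v)))) ≗ agrees
  dual-disagrees≗agrees i =
    trans (cong (λ p → not (does (dual f v ≟ᵇ f (flip i v) xor p))) (parity-flip i v))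
          (disagreesᵇ-xor-not (f v) (f (flip i v)) (parity v))

m+n≡o⇒[m≡k⇔n≡o∸k] : ∀ {m n o k} → m + n ≡ o → k ≤ o → m ≡ k ⇔ n ≡ o ∸ k
m+n≡o⇒[m≡k⇔n≡o∸k] {m} {n} {o} {k} m+n≡o k≤o = mk⇔
  (λ m≡k → trans (sym (m+n∸m≡n m n)) (trans (cong (_∸ m) m+n≡o) (cong (o ∸_) m≡k)))
  (λ n≡o∸k → trans (sym (m+n∸n≡m m n))
               (trans (cong (_∸ n) m+n≡o) (trans (cong (o ∸_) n≡o∸k) (m∸[m∸n]≡n k≤o))))

disagree-cong : {f g : BoolFun n} → f ≗ g → ∀ v → disagree f v ≡ disagree g v
disagree-cong {n} f≗g v = count-cong (λ w → cong₂ (λ a b → not (does (a ≟ᵇ b))) (f≗g v) (f≗g w))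
                                     (map (λ i → flip i v) (toList (allFin n)))

disagree-dual≡⇔ : ∀ {k} → k ≤ n → (f : BoolFun n) → ∀ v →
  disagree (dual f) v ≡ k ⇔ disagree f v ≡ n ∸ k
disagree-dual≡⇔ k≤n f v = m+n≡o⇒[m≡k⇔n≡o∸k] (disagree-dual+disagree f v) k≤n

IsKFun-cong : ∀ {k} {f g : BoolFun n} → f ≗ g → IsKFun k f → IsKFun k g
IsKFun-cong f≗g kf v = trans (sym (disagree-cong f≗g v)) (kf v)

IsKFun-dual⇔ : ∀ {k} → k ≤ n → (f : BoolFun n) → IsKFun k (dual f) ⇔ IsKFun (n ∸ k) f
IsKFun-dual⇔ k≤n f = mk⇔ (λ kf v → Equivalence.to (disagree-dual≡⇔ k≤n f v) (kf v))
                         (λ kf v → Equivalence.from (disagree-dual≡⇔ k≤n f v) (kf v))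

isKFunᵇ-cong : ∀ k {f g : BoolFun n} → f ≗ g → isKFunᵇ k f ≡ isKFunᵇ k g
isKFunᵇ-cong {n} k f≗g = allᵇ-cong (λ v → cong (_≡ᵇ k) (disagree-cong f≗g v)) (allVertices n)

isKFunᵇ-dual : ∀ {k} → k ≤ n → (f : BoolFun n) → isKFunᵇ k (dual f) ≡ isKFunᵇ (n ∸ k) f
isKFunᵇ-dual {n} k≤n f =
  allᵇ-cong (λ v → does-⇔ (disagree-dual≡⇔ k≤n f v) (_ ≟ _) (_ ≟ _)) (allVertices n)

F-dual : ∀ {n k} → k ≤ n → F n k ≡ F n (n ∸ k)
F-dual {n} {k} k≤n = begin
  count (isKFunᵇ k) Fs                           ≡⟨ count≡sum (isKFunᵇ k) Fs ⟩
  sum (map (indicator ∘ isKFunᵇ k) Fs)           ≡⟨ twistInvariant n parity _ (cong indicator ∘ isKFunᵇ-cong k) ⟨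
  sum (map (indicator ∘ isKFunᵇ k ∘ dual) Fs)    ≡⟨ cong sum (map-cong (cong indicator ∘ isKFunᵇ-dual k≤n) Fs) ⟩
  sum (map (indicator ∘ isKFunᵇ (n ∸ k)) Fs)     ≡⟨ count≡sum (isKFunᵇ (n ∸ k)) Fs ⟨
  count (isKFunᵇ (n ∸ k)) Fs                     ∎
  where
  open ≡-Reasoning
  Fs = allFuns n

-- Automorphisms preserve or reverse parity

dist-refl : (v : Vertex n) → dist v v ≡ 0
dist-refl []          = refl
dist-refl (false ∷ v) = dist-refl v
dist-refl (true ∷ v)  = dist-refl v

dist≡0⇒≡ : (v w : Vertex n) → dist v w ≡ 0 → v ≡ w
dist≡0⇒≡ []          []          _ = refl
dist≡0⇒≡ (false ∷ v) (false ∷ w) d = cong (false ∷_) (dist≡0⇒≡ v w d)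
dist≡0⇒≡ (true ∷ v)  (true ∷ w)  d = cong (true ∷_) (dist≡0⇒≡ v w d)
dist≡0⇒≡ (false ∷ v) (true ∷ w)  ()
dist≡0⇒≡ (true ∷ v)  (false ∷ w) ()

flip-adjacent : ∀ (i : Fin n) v → Adj v (flip i v)
flip-adjacent fzero    (false ∷ v) = cong suc (dist-refl v)
flip-adjacent fzero    (true ∷ v)  = cong suc (dist-refl v)
flip-adjacent (fsuc i) (false ∷ v) = flip-adjacent i v
flip-adjacent (fsuc i) (true ∷ v)  = flip-adjacent i v

parity-adjacent : (v w : Vertex n) → Adj v w → parity w ≡ not (parity v)
parity-adjacent []          []          ()
parity-adjacent (false ∷ v) (false ∷ w) adj = parity-adjacent v w adj
parity-adjacent (true ∷ v)  (true ∷ w)  adj = cong not (parity-adjacent v w adj)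
parity-adjacent (false ∷ v) (true ∷ w)  adj =
  cong (not ∘ parity) (sym (dist≡0⇒≡ v w (suc-injective adj)))
parity-adjacent (true ∷ v)  (false ∷ w) adj =
  trans (cong parity (sym (dist≡0⇒≡ v w (suc-injective adj)))) (sym (not-involutive (parity v)))

flip-invariant⇒constant : (h : Vertex n → A) → (∀ i v → h (flip i v) ≡ h v) → ∀ v w → h v ≡ h w
flip-invariant⇒constant h invariant [] [] = refl
flip-invariant⇒constant h invariant (a ∷ v) (b ∷ w) =
  trans (change-head a b)
        (flip-invariant⇒constant (h ∘ (b ∷_)) (λ i u → invariant (fsuc i) (b ∷ u)) v w)
  where
  change-head : ∀ a b → h (a ∷ v) ≡ h (b ∷ v)
  change-head false false = refl
  change-head true  true  = refl
  change-head false true  = sym (invariant fzero (false ∷ v))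
  change-head true  false = sym (invariant fzero (true ∷ v))

parity-automorphism : (φ : Automorphism n) →
  ∃[ s ] ∀ x → parity (Inverse.to (Automorphism.bij φ) x) ≡ s xor parity x
parity-automorphism {n} aut = shift (replicate n false) , λ x → begin
  parity (φ x)                          ≡⟨ xor-cancelʳ (parity (φ x)) (parity x) ⟨
  shift x xor parity x                  ≡⟨ cong (_xor parity x) (shift-constant x (replicate n false)) ⟩
  shift (replicate n false) xor parity x ∎
  where
  open ≡-Reasoning
  φ = Inverse.to (Automorphism.bij aut)
  shift : Vertex n → Bool
  shift x = parity (φ x) xor parity x
  shift-constant : ∀ x y → shift x ≡ shift y
  shift-constant = flip-invariant⇒constant shift λ i v →
    trans (cong₂ _xor_ (parity-adjacent (φ v) (φ (flip i v)) (proj₁ (Automorphism.preserve aut v (flip i v)) (flip-adjacent i v)))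
                       (parity-flip i v))
          (xor-annihilates-not (parity (φ v)) (parity v))

applySign-xorʳ : ∀ ε b p → applySign ε b xor p ≡ applySign ε (b xor p)
applySign-xorʳ true  b p = refl
applySign-xorʳ false b p = sym (not-distribˡ-xor b p)

applySign-xor-shift : ∀ s ε b p → applySign (s xor ε) (b xor (s xor p)) ≡ applySign ε (b xor p)
applySign-xor-shift false ε     b p = refl
applySign-xor-shift true  true  b p = trans (cong not (sym (not-distribʳ-xor b p))) (not-involutive _)
applySign-xor-shift true  false b p = sym (not-distribʳ-xor b p)

Isomorphic-cong : {f f′ g g′ : BoolFun n} → f ≗ f′ → g ≗ g′ → Isomorphic f g → Isomorphic f′ g′
Isomorphic-cong f≗f′ g≗g′ (φ , ε , f≡εg∘φ) =
  φ , ε , λ x → trans (sym (f≗f′ x)) (trans (f≡εg∘φ x) (cong (applySign ε) (g≗g′ _)))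

Isomorphic-dual : {f g : BoolFun n} → Isomorphic f g → Isomorphic (dual f) (dual g)
Isomorphic-dual {f = f} {g} (aut , ε , f≡εg∘φ) with parity-automorphism aut
... | s , parity∘φ = aut , s xor ε , λ x → begin
  f x xor parity x                             ≡⟨ cong (_xor parity x) (f≡εg∘φ x) ⟩
  applySign ε (g (φ x)) xor parity x           ≡⟨ applySign-xorʳ ε (g (φ x)) (parity x) ⟩
  applySign ε (g (φ x) xor parity x)           ≡⟨ applySign-xor-shift s ε (g (φ x)) (parity x) ⟨
  applySign (s xor ε) (g (φ x) xor (s xor parity x))
                                               ≡⟨ cong (λ p → applySign (s xor ε) (g (φ x) xor p)) (parity∘φ x) ⟨
  applySign (s xor ε) (g (φ x) xor parity (φ x)) ∎
  where
  open ≡-Reasoning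
  φ = Inverse.to (Automorphism.bij aut)

Isomorphic-undual : {f g : BoolFun n} → Isomorphic (dual f) (dual g) → Isomorphic f g
Isomorphic-undual {f = f} {g} =
  Isomorphic-cong (dual-involutive f) (dual-involutive g) ∘ Isomorphic-dual {f = dual f} {dual g}

IsG-dual : ∀ {n k m} → k ≤ n → IsG n k m → IsG n (n ∸ k) m
IsG-dual k≤n (reps , |reps|≡m , reps-kFun , reps-distinct , reps-cover) =
  map dual reps ,
  trans (length-map dual reps) |reps|≡m ,
  All.map⁺ (All.map (λ {f} kf → to (IsKFun-dual⇔ k≤n (dual f)) (IsKFun-cong {g = dual (dual f)} (sym ∘ dual-involutive f) kf))
                     reps-kFun) ,
  AllPairs.map⁺ (AllPairs.map (λ {f} {g} ¬iso iso → ¬iso (Isomorphic-undual {f = f} {g} iso)) reps-distinct) ,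
  λ f kf → Any.map⁺ (Any.map (λ {g} → Isomorphic-cong {f = dual (dual f)} {g = dual g}
                                          (dual-involutive f) (λ _ → refl) ∘ Isomorphic-dual {g = g})
                             (reps-cover (dual f) (from (IsKFun-dual⇔ k≤n f) kf)))
  where open Equivalence

lemma6 : (n k : ℕ) → k ≤ n →
    F n k ≡ F n (n ∸ k) × (∀ m → IsG n k m ⇔ IsG n (n ∸ k) m)
lemma6 n k k≤n = F-dual k≤n , λ m → mk⇔ (IsG-dual k≤n) (back m)
  where
  back : ∀ m → IsG n (n ∸ k) m → IsG n k m
  back m = subst (λ j → IsG n j m) (m∸[m∸n]≡n k≤n) ∘ IsG-dual (m∸n≤m n k)
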